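{- If $\Gamma$ is a sequent derivable in $\mathsf{MLL}_{SC}$, then $$\big(n^-_{\otimes}(\Gamma)+n^+_{\wp}(\Gamma)+n_{co}(\Gamma)\big)-\big(n^+_{\otimes}(\Gamma)+n^-_{\wp}(\Gamma)\big)=1.$$
   Context: $\wp$ denotes par and $\otimes$ tensor. Formulae are built from atoms and negated atoms using $\otimes,\wp$, with $\overline{A\otimes B}=\overline{A}\wp\overline{B}$, $\overline{A\wp B}=\overline{A}\otimes\overline{B}$, $\overline{\overline{A}}=A$. A sequent is a finite list $\vdash A_1,\dots,A_n$. The one-sided sequent calculus $\mathsf{MLL}_{SC}$ has the rules: $\mathsf{id}$: $\vdash\overline{A},A$ (no premise); $\mathsf{exch}$: from $\vdash\Gamma,A,B,\Delta$ infer $\vdash\Gamma,B,A,\Delta$; $\wp$: from $\vdash\Gamma,A,B,\Delta$ infer $\vdash\Gamma,A\wp B,\Delta$; $\otimes$: from $\vdash\Gamma,A$ and $\vdash B,\Delta$ infer $\vdash\Gamma,A\otimes B,\Delta$; $\mathsf{cut}$: from $\vdash\Gamma,A$ and $\vdash\overline{A},\Delta$ infer $\vdash\Gamma,\Delta$. A connective occurrence occurs positively if the number of negation overlines above it is even, negatively otherwise (formulas may be read as expressions with overlines, equivalent up to the DeMorgan laws). For a sequent $\Gamma=A_1,\dots,A_n$, $n^{\pm}_{\otimes}(\Gamma)=\sum_i n^{\pm}_{\otimes}(A_i)$ and $n^{\pm}_{\wp}(\Gamma)=\sum_i n^{\pm}_{\wp}(A_i)$, where $n^{+}_{\otimes}(A)$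 counts positive occurrences of $\otimes$ in $A$ etc.; $n_{co}(\Gamma)$ is the number of commas in $\Gamma$. -}

module Defs where

open import Data.Nat using (ℕ; zero; suc; _+_; _∸_)
open import Data.List using (List; []; _∷_; _++_; [_]; length)

data Formula : Set where
  atom  : ℕ → Formula
  natom : ℕ → Formula
  _⊗_   : Formula → Formula → Formula
  _⅋_   : Formula → Formula → Formula

infixr 6 _⊗_ _⅋_

‾_ : Formula → Formula
‾ atom x  = natom x
‾ natom x = atom x
‾ (A ⊗ B) = (‾ A) ⅋ (‾ B)
‾ (A ⅋ B) = (‾ A) ⊗ (‾ B)

Sequent : Set
Sequent = List Formula

data ⊢_ : Sequent → Set where
  id   : ∀ A → ⊢ (‾ A ∷ A ∷ [])
  exch : ∀ Γ A B Δ → ⊢ (Γ ++ A ∷ B ∷ Δ) → ⊢ (Γ ++ B ∷ A ∷ Δ)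
  par  : ∀ Γ A B Δ → ⊢ (Γ ++ A ∷ B ∷ Δ) → ⊢ (Γ ++ (A ⅋ B) ∷ Δ)
  tens : ∀ Γ A B Δ → ⊢ (Γ ++ [ A ]) → ⊢ (B ∷ Δ) → ⊢ (Γ ++ (A ⊗ B) ∷ Δ)
  cut  : ∀ Γ A Δ → ⊢ (Γ ++ [ A ]) → ⊢ (‾ A ∷ Δ) → ⊢ (Γ ++ Δ)

-- polarity of an occurrence (even / odd number of overlines above it)
data Pol : Set where
  pos neg : Pol

-- Formulas are in negation normal form: overlines only sit on atoms,
-- so connective occurrences are under zero overlines (positive).
n⊗ : Pol → Formula → ℕ
n⊗ p (atom _)  = 0
n⊗ p (natom _) = 0
n⊗ pos (A ⊗ B) = suc (n⊗ pos A + n⊗ pos B)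
n⊗ neg (A ⊗ B) = n⊗ neg A + n⊗ neg B
n⊗ p (A ⅋ B)   = n⊗ p A + n⊗ p B

n⅋ : Pol → Formula → ℕ
n⅋ p (atom _)  = 0
n⅋ p (natom _) = 0
n⅋ pos (A ⅋ B) = suc (n⅋ pos A + n⅋ pos B)
n⅋ neg (A ⅋ B) = n⅋ neg A + n⅋ neg B
n⅋ p (A ⊗ B)   = n⅋ p A + n⅋ p B

n⊗ₛ : Pol → Sequent → ℕ
n⊗ₛ p []      = 0
n⊗ₛ p (A ∷ Γ) = n⊗ p A + n⊗ₛ p Γ

n⅋ₛ : Pol → Sequent → ℕ
n⅋ₛ p []      = 0
n⅋ₛ p (A ∷ Γ) = n⅋ p A + n⅋ₛ p Γ

-- number of commas in a sequent A₁,…,Aₙ  (n - 1, and 0 for the empty sequent)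
nco : Sequent → ℕ
nco Γ = length Γ ∸ 1

-- Give each formula A the weight 1 + #⅋(A) − #⊗(A) and a sequent the sum of the
-- weights of its formulas. Every derivable sequent has weight 2: an axiom ‾A, A
-- does because negation swaps ⊗ and ⅋; exchange and ⅋ do not change the weight;
-- ⊗ and cut join two sequents of weight 2 and lose exactly 2. Formulas are in
-- negation normal form, so the negative counts vanish, and weight 2 is the claimed
-- identity once the number of commas is read as the length minus one (derivable
-- sequents being nonempty).
module Submission where

open import Defs
open import Data.Empty using (⊥-elim)
open import Data.Integer using (ℤ; +_; _+_; _-_)
open import Data.Integer.Properties using (+-identityˡ; +-identityʳ; +-assoc; pos-+)
open import Data.Integer.Tactic.RingSolver using (solve-∀)
open import Data.List using ([]; _∷_; _++_; [_]; length)
open import Data.Nat as ℕ using (suc)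
open import Relation.Binary.PropositionalEquality
  using (_≡_; refl; cong; cong₂; sym; trans; module ≡-Reasoning)
open import Relation.Nullary using (¬_)
open ≡-Reasoning

n⊗-neg≡0 : ∀ A → n⊗ neg A ≡ 0
n⊗-neg≡0 (atom _)  = refl
n⊗-neg≡0 (natom _) = refl
n⊗-neg≡0 (A ⊗ B)   = cong₂ ℕ._+_ (n⊗-neg≡0 A) (n⊗-neg≡0 B)
n⊗-neg≡0 (A ⅋ B)   = cong₂ ℕ._+_ (n⊗-neg≡0 A) (n⊗-neg≡0 B)

n⅋-neg≡0 : ∀ A → n⅋ neg A ≡ 0
n⅋-neg≡0 (atom _)  = refl
n⅋-neg≡0 (natom _) = refl
n⅋-neg≡0 (A ⊗ B)   = cong₂ ℕ._+_ (n⅋-neg≡0 A) (n⅋-neg≡0 B)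
n⅋-neg≡0 (A ⅋ B)   = cong₂ ℕ._+_ (n⅋-neg≡0 A) (n⅋-neg≡0 B)

n⊗ₛ-neg≡0 : ∀ Γ → n⊗ₛ neg Γ ≡ 0
n⊗ₛ-neg≡0 []      = refl
n⊗ₛ-neg≡0 (A ∷ Γ) = cong₂ ℕ._+_ (n⊗-neg≡0 A) (n⊗ₛ-neg≡0 Γ)

n⅋ₛ-neg≡0 : ∀ Γ → n⅋ₛ neg Γ ≡ 0
n⅋ₛ-neg≡0 []      = refl
n⅋ₛ-neg≡0 (A ∷ Γ) = cong₂ ℕ._+_ (n⅋-neg≡0 A) (n⅋ₛ-neg≡0 Γ)

n⊗-‾ : ∀ A → n⊗ pos (‾ A) ≡ n⅋ pos A
n⅋-‾ : ∀ A → n⅋ pos (‾ A) ≡ n⊗ pos A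
n⊗-‾ (atom _)  = refl
n⊗-‾ (natom _) = refl
n⊗-‾ (A ⊗ B)   = cong₂ ℕ._+_ (n⊗-‾ A) (n⊗-‾ B)
n⊗-‾ (A ⅋ B)   = cong suc (cong₂ ℕ._+_ (n⊗-‾ A) (n⊗-‾ B))
n⅋-‾ (atom _)  = refl
n⅋-‾ (natom _) = refl
n⅋-‾ (A ⊗ B)   = cong suc (cong₂ ℕ._+_ (n⅋-‾ A) (n⅋-‾ B))
n⅋-‾ (A ⅋ B)   = cong₂ ℕ._+_ (n⅋-‾ A) (n⅋-‾ B)

weight : Formula → ℤ
weight A = + n⅋ pos A - + n⊗ pos A + + 1

weightₛ : Sequent → ℤ
weightₛ []      = + 0
weightₛ (A ∷ Γ) = weight A + weightₛ Γ

weight-‾ : ∀ A → weight (‾ A) + weight A ≡ + 2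
weight-‾ A rewrite n⊗-‾ A | n⅋-‾ A = lemma (+ n⊗ pos A) (+ n⅋ pos A)
  where
  lemma : ∀ t p → (t - p + + 1) + (p - t + + 1) ≡ + 2
  lemma = solve-∀

weight-⅋ : ∀ A B → weight (A ⅋ B) ≡ weight A + weight B
weight-⅋ A B = lemma (+ n⅋ pos A) (+ n⅋ pos B) (+ n⊗ pos A) (+ n⊗ pos B)
  where
  lemma : ∀ p q s t → + 1 + (p + q) - (s + t) + + 1 ≡ (p - s + + 1) + (q - t + + 1)
  lemma = solve-∀

weight-⊗ : ∀ A B → weight (A ⊗ B) ≡ weight A + weight B - + 2
weight-⊗ A B = lemma (+ n⅋ pos A) (+ n⅋ pos B) (+ n⊗ pos A) (+ n⊗ pos B)
  where
  lemma : ∀ p q s t → p + q - (+ 1 + (s + t)) + + 1 ≡ (p - s + + 1) + (q - t + + 1) - + 2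
  lemma = solve-∀

weightₛ-++ : ∀ Γ Δ → weightₛ (Γ ++ Δ) ≡ weightₛ Γ + weightₛ Δ
weightₛ-++ []      Δ = sym (+-identityˡ (weightₛ Δ))
weightₛ-++ (A ∷ Γ) Δ = trans (cong (λ x → weight A + x) (weightₛ-++ Γ Δ))
                             (sym (+-assoc (weight A) (weightₛ Γ) (weightₛ Δ)))

weightₛ-∷ʳ : ∀ Γ A → weightₛ (Γ ++ [ A ]) ≡ weightₛ Γ + weight A
weightₛ-∷ʳ Γ A = trans (weightₛ-++ Γ [ A ]) (cong (λ x → weightₛ Γ + x) (+-identityʳ (weight A)))

weightₛ-congˡ : ∀ Γ {Δ Δ′} → weightₛ Δ ≡ weightₛ Δ′ → weightₛ (Γ ++ Δ) ≡ weightₛ (Γ ++ Δ′)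
weightₛ-congˡ []      eq = eq
weightₛ-congˡ (A ∷ Γ) eq = cong (λ x → weight A + x) (weightₛ-congˡ Γ eq)

weightₛ-swap : ∀ A B Δ → weightₛ (B ∷ A ∷ Δ) ≡ weightₛ (A ∷ B ∷ Δ)
weightₛ-swap A B Δ = lemma (weight A) (weight B) (weightₛ Δ)
  where
  lemma : ∀ a b d → b + (a + d) ≡ a + (b + d)
  lemma = solve-∀

weightₛ-⅋ : ∀ A B Δ → weightₛ ((A ⅋ B) ∷ Δ) ≡ weightₛ (A ∷ B ∷ Δ)
weightₛ-⅋ A B Δ = trans (cong (λ x → x + weightₛ Δ) (weight-⅋ A B))
                        (+-assoc (weight A) (weight B) (weightₛ Δ))

weightₛ-derivable : ∀ {Γ} → ⊢ Γ → weightₛ Γ ≡ + 2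
weightₛ-derivable (id A) = trans (cong (λ x → weight (‾ A) + x) (+-identityʳ (weight A))) (weight-‾ A)
weightₛ-derivable (exch Γ A B Δ d) =
  trans (weightₛ-congˡ Γ (weightₛ-swap A B Δ)) (weightₛ-derivable d)
weightₛ-derivable (par Γ A B Δ d) =
  trans (weightₛ-congˡ Γ (weightₛ-⅋ A B Δ)) (weightₛ-derivable d)
weightₛ-derivable (tens Γ A B Δ d e) = begin
  weightₛ (Γ ++ (A ⊗ B) ∷ Δ)                            ≡⟨ weightₛ-++ Γ _ ⟩
  weightₛ Γ + (weight (A ⊗ B) + weightₛ Δ)              ≡⟨ cong (λ x → weightₛ Γ + (x + weightₛ Δ)) (weight-⊗ A B) ⟩
  weightₛ Γ + (weight A + weight B - + 2 + weightₛ Δ)  ≡⟨ lemma (weightₛ Γ) (weight A) (weight B) (weightₛ Δ) ⟩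
  (weightₛ Γ + weight A) + weightₛ (B ∷ Δ) - + 2       ≡⟨ cong₂ (λ x y → x + y - + 2) left (weightₛ-derivable e) ⟩
  + 2                                                   ∎
  where
  left : weightₛ Γ + weight A ≡ + 2
  left = trans (sym (weightₛ-∷ʳ Γ A)) (weightₛ-derivable d)
  lemma : ∀ g a b d → g + (a + b - + 2 + d) ≡ (g + a) + (b + d) - + 2
  lemma = solve-∀
weightₛ-derivable (cut Γ A Δ d e) = begin
  weightₛ (Γ ++ Δ)                                               ≡⟨ weightₛ-++ Γ Δ ⟩
  weightₛ Γ + weightₛ Δ                                          ≡⟨ lemma (weightₛ Γ) (weight A) (weight (‾ A)) (weightₛ Δ) ⟩
  (weightₛ Γ + weight A) + weightₛ (‾ A ∷ Δ) - (weight (‾ A) + weight A)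
    ≡⟨ cong₂ (λ x y → x + y - (weight (‾ A) + weight A)) left (weightₛ-derivable e) ⟩
  + 4 - (weight (‾ A) + weight A)                                ≡⟨ cong (λ x → + 4 - x) (weight-‾ A) ⟩
  + 2                                                            ∎
  where
  left : weightₛ Γ + weight A ≡ + 2
  left = trans (sym (weightₛ-∷ʳ Γ A)) (weightₛ-derivable d)
  lemma : ∀ g a a′ d → g + d ≡ (g + a) + (a′ + d) - (a′ + a)
  lemma = solve-∀

weightₛ-counts : ∀ Γ → weightₛ Γ ≡ + n⅋ₛ pos Γ - + n⊗ₛ pos Γ + + length Γ
weightₛ-counts []      = refl
weightₛ-counts (A ∷ Γ) = begin
  weight A + weightₛ Γ
    ≡⟨ cong (λ x → weight A + x) (weightₛ-counts Γ) ⟩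
  (p - t + + 1) + (ps - ts + l)
    ≡⟨ lemma p ps t ts l ⟩
  (p + ps) - (t + ts) + (+ 1 + l)
    ≡⟨ sym (cong₂ (λ x y → x - y + + suc (length Γ))
                  (pos-+ (n⅋ pos A) (n⅋ₛ pos Γ)) (pos-+ (n⊗ pos A) (n⊗ₛ pos Γ))) ⟩
  + n⅋ₛ pos (A ∷ Γ) - + n⊗ₛ pos (A ∷ Γ) + + length (A ∷ Γ) ∎
  where
  p = + n⅋ pos A
  ps = + n⅋ₛ pos Γ
  t = + n⊗ pos A
  ts = + n⊗ₛ pos Γ
  l = + length Γ
  lemma : ∀ p ps t ts l → (p - t + + 1) + (ps - ts + l) ≡ (p + ps) - (t + ts) + (+ 1 + l)
  lemma = solve-∀

¬⊢[] : ¬ ⊢ []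
¬⊢[] d with weightₛ-derivable d
... | ()

theorem3p6 : (Γ : Sequent) → ⊢ Γ →
    ((+ n⊗ₛ neg Γ) + (+ n⅋ₛ pos Γ) + (+ nco Γ)) - ((+ n⊗ₛ pos Γ) + (+ n⅋ₛ neg Γ)) ≡ + 1
theorem3p6 []      d = ⊥-elim (¬⊢[] d)
theorem3p6 (A ∷ Γ) d rewrite n⊗ₛ-neg≡0 (A ∷ Γ) | n⅋ₛ-neg≡0 (A ∷ Γ) =
  conclude (+ n⅋ₛ pos (A ∷ Γ)) (+ n⊗ₛ pos (A ∷ Γ)) (+ length Γ)
           (trans (sym (weightₛ-counts (A ∷ Γ))) (weightₛ-derivable d))
  where
  conclude : ∀ p t l → p - t + (+ 1 + l) ≡ + 2 → (+ 0 + p + l) - (t + + 0) ≡ + 1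
  conclude p t l h = trans (lemma p t l) (cong (λ x → x - + 1) h)
    where
    lemma : ∀ p t l → (+ 0 + p + l) - (t + + 0) ≡ (p - t + (+ 1 + l)) - + 1
    lemma = solve-∀
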